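{- For every positive integer $h$, $|\Omega_{pos}(h)| = S_h$, where $S_n$ denotes the super Catalan number (OEIS A001003).
   Context: For a positive integer $h$, let $\Omega(h)$ be the set of pairs $(x,\pi)$ where $x=(x_1,\dots,x_h)\in\{0,U,E\}^h$ and $\pi$ is a non-crossing partition of $Z=\{i : x_i \neq 0\}$ (no $a<b<c<d$ in $Z$ with $a,c$ in one block and $b,d$ in a different block), such that every block of $\pi$ contains an even number (possibly zero) of indices $i$ with $x_i=U$, and every singleton block $\{i\}$ has $x_i=E$. Let $\Omega_{pos}(h)$ be the subset of pairs with $x_i \neq 0$ for all $i$. The super Catalan numbers (little Schröder numbers) $S_0,S_1,S_2,\dots = 1,1,3,11,45,197,\dots$ are defined by the generating function $\sum_{n\ge 0} S_n x^n = \frac{1+x-\sqrt{1-6x+x^2}}{4x}$. -}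

module Defs where

open import Data.Bool using (Bool; true; false)
open import Data.Nat using (ℕ; zero; suc; _*_; _∸_)
open import Data.Nat.Divisibility using (_∣_; _∣?_)
open import Data.Fin using (Fin; _<_; _<?_)
open import Data.Fin.Properties using (all?) renaming (_≟_ to _≟ᶠ_)
open import Data.Product using (_×_; _,_; proj₁; proj₂)
open import Data.List using (List; []; _∷_; length; filter; allFin; cartesianProduct; concatMap; map)
open import Data.Vec as Vec using (Vec; []; _∷_; lookup; zipWith; reverse; last; _∷ʳ_)
import Data.Bool.Properties as BoolP
open import Relation.Nullary using (¬_; Dec; yes; no)
open import Relation.Nullary.Decidable using (_×-dec_; _→-dec_; ¬?)
open import Relation.Binary.PropositionalEquality using (_≡_; _≢_; refl)

-- Writing f(x) = Σ S_n x^n = (1 + x - √(1 - 6x + x²)) / (4x), f is the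
-- power series root of  2x f² - (1 + x) f + 1 = 0, i.e. S_0 = 1 and for
-- n ≥ 0:  S_{n+1} + S_n = 2 Σ_{i+j=n} S_i S_j.
-- superCatalanUpTo n = (S_0, …, S_n).

superCatalanUpTo : (n : ℕ) → Vec ℕ (suc n)
superCatalanUpTo zero    = 1 ∷ []
superCatalanUpTo (suc n) =
  let v = superCatalanUpTo n
  in  v ∷ʳ (2 * Vec.sum (zipWith _*_ v (reverse v)) ∸ last v)

superCatalan : ℕ → ℕ
superCatalan n = last (superCatalanUpTo n)

data Letter : Set where
  O U E : Letter

_≟L_ : (a b : Letter) → Dec (a ≡ b)
O ≟L O = yes refl
O ≟L U = no λ ()
O ≟L E = no λ ()
U ≟L O = no λ ()
U ≟L U = yes refl
U ≟L E = no λ ()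
E ≟L O = no λ ()
E ≟L U = no λ ()
E ≟L E = yes refl

-- A word x ∈ {0,U,E}^h is a  Vec Letter h  (index i : Fin h is position i+1).
-- A partition π of Z = {i : x_i ≠ 0} is encoded by its equivalence
-- relation "i and j lie in the same block", given as a boolean h×h
-- matrix R which is an equivalence relation on Z and relates nothing
-- outside Z.  (Partitions of Z ↔ such matrices, bijectively.)

module _ {h : ℕ} (x : Vec Letter h) (R : Vec (Vec Bool h) h) where

  InZ : Fin h → Set
  InZ i = lookup x i ≢ O

  Same : Fin h → Fin h → Set
  Same i j = lookup (lookup R i) j ≡ true

  Same? : ∀ i j → Dec (Same i j)
  Same? i j = lookup (lookup R i) j BoolP.≟ true

  InZ? : ∀ i → Dec (InZ i)
  InZ? i = ¬? (lookup x i ≟L O)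

  IsPartitionOfZ : Set
  IsPartitionOfZ =
      (∀ i j → Same i j → InZ i × InZ j)
    × (∀ i → InZ i → Same i i)
    × (∀ i j → Same i j → Same j i)
    × (∀ i j k → Same i j → Same j k → Same i k)

  NonCrossing : Set
  NonCrossing = ∀ a b c d →
    ¬ (a < b × b < c × c < d × Same a c × Same b d × ¬ Same a b)

  uCountInBlock : Fin h → ℕ
  uCountInBlock i = length (filter (λ j → Same? i j ×-dec (lookup x j ≟L U)) (allFin h))

  EvenU : Set
  EvenU = ∀ i → InZ i → 2 ∣ uCountInBlock i

  SingletonsE : Set
  SingletonsE = ∀ i → InZ i → (∀ j → Same i j → j ≡ i) → lookup x i ≡ E

  InΩ : Set
  InΩ = IsPartitionOfZ × NonCrossing × EvenU × SingletonsE

  InΩpos : Set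
  InΩpos = InΩ × (∀ i → InZ i)

  InΩpos? : Dec InΩpos
  InΩpos? =
    (  ((all? λ i → all? λ j → Same? i j →-dec (InZ? i ×-dec InZ? j))
    ×-dec (all? λ i → InZ? i →-dec Same? i i)
    ×-dec (all? λ i → all? λ j → Same? i j →-dec Same? j i)
    ×-dec (all? λ i → all? λ j → all? λ k → Same? i j →-dec (Same? j k →-dec Same? i k)))
    ×-dec (all? λ a → all? λ b → all? λ c → all? λ d →
             ¬? ((a <? b) ×-dec (b <? c) ×-dec (c <? d) ×-dec Same? a c
                 ×-dec Same? b d ×-dec ¬? (Same? a b)))
    ×-dec (all? λ i → InZ? i →-dec (2 ∣? uCountInBlock i))
    ×-dec (all? λ i → InZ? i →-dec ((all? λ j → Same? i j →-dec (j ≟ᶠ i)) →-dec (lookup x i ≟L E))))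
    ×-dec (all? InZ?)

allVecs : {A : Set} → List A → (n : ℕ) → List (Vec A n)
allVecs xs zero    = [] ∷ []
allVecs xs (suc n) = concatMap (λ a → map (a ∷_) (allVecs xs n)) xs

allLetters : List Letter
allLetters = O ∷ U ∷ E ∷ []

allBools : List Bool
allBools = false ∷ true ∷ []

candidates : (h : ℕ) → List (Vec Letter h × Vec (Vec Bool h) h)
candidates h = cartesianProduct (allVecs allLetters h) (allVecs (allVecs allBools h) h)

cardΩpos : ℕ → ℕ
cardΩpos h = length (filter (λ p → InΩpos? (proj₁ p) (proj₂ p)) (candidates h))

{-# OPTIONS --safe #-}
module Submission where

-- Position 0 of a structure in Ω_pos(m) is either a singleton block, or its block has a largest
-- element J > 0. In the second case, removing J leaves a structure on [0, J) whose first block has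
-- its U-parity shifted by the letter at J, while the positions after J carry an independent
-- structure, since a block meeting both sides of J would cross the block of 0. Keeping track of
-- the U-parity p of the first block, Ω_pos is in bijection with the trees of the grammar
--   T(n + 1, p) = T(n, even) + Σ_{j + 1 + k = n} Σ_{b} T(j + 1, p + b) × T(k, even),
-- and for either parity this gives S_n + 2 Σ_{j + 1 + k = n} S_{j + 1} S_k = S_{n + 1} trees of
-- size n + 1, which is the recurrence defining the super Catalan numbers.

open import Defs
open import Data.Bool using (Bool; true; false; not; _∧_; _xor_)
open import Data.Bool.Properties
  using (not-involutive; xor-assoc; xor-same; xor-identityʳ; ∧-zeroʳ; ∧-distribˡ-xor; ¬-not)
open import Data.Empty using (⊥; ⊥-elim)
open import Data.Fin as Fin using (Fin; toℕ; fromℕ; fromℕ<; inject₁; opposite)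
open import Data.Fin.Properties
  using (toℕ<n; toℕ-fromℕ; toℕ-fromℕ<; toℕ-inject₁; opposite-prop; opposite-involutive)
open import Data.List as List
  using (List; []; _∷_; _++_; map; concatMap; cartesianProductWith; length; filter)
open import Data.List.Properties using (length-++; length-map; map-cong; map-∘)
open import Data.List.Membership.Propositional using (_∈_; find)
open import Data.List.Membership.Propositional.Properties
  using (∈-map⁺; ∈-map⁻; ∈-++⁺ˡ; ∈-++⁺ʳ; ∈-concat⁺′; ∈-concatMap⁻; ∈-filter⁺; ∈-filter⁻;
         ∈-cartesianProduct⁺; ∈-cartesianProductWith⁺; ∈-cartesianProductWith⁻)
open import Data.List.Membership.Propositional.Properties.WithK using (unique∧set⇒bag)
open import Data.List.Relation.Binary.BagAndSetEquality using (∼bag⇒↭)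
open import Data.List.Relation.Binary.Permutation.Propositional.Properties using (↭-length)
open import Data.List.Relation.Unary.All as All using ()
open import Data.List.Relation.Unary.All.Properties using () renaming (map⁺ to All-map⁺)
open import Data.List.Relation.Unary.AllPairs as AllPairs using ([]; _∷_)
import Data.List.Relation.Unary.AllPairs.Properties as AllPairs
open import Data.List.Relation.Unary.Any using (here; there)
open import Data.List.Relation.Unary.Unique.Propositional using (Unique)
open import Data.List.Relation.Unary.Unique.Propositional.Properties
  using (++⁺; map⁺; concat⁺; filter⁺; cartesianProduct⁺; cartesianProductWith⁺)
open import Data.Nat using (ℕ; zero; suc; _+_; _*_; _∸_; _≤_; _<_; z≤n; s≤s)
open import Data.Nat.Divisibility using (_∣_; divides)
open import Data.Nat.Induction using (<-rec)
open import Data.Nat.ListAction using (sum)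
open import Data.Nat.Properties
  using (≤-refl; ≤-trans; ≤-pred; <-trans; ≤-<-trans; <-≤-trans; <⇒≤; <⇒≱; <-cmp;
         m≤n⇒m≤1+n; m<1+n⇒m<n∨m≡n; m≤m+n; m≤n+m; m≤n⇒∃[o]m+o≡n; +-monoʳ-<; +-cancelˡ-<; +-cancelˡ-≡;
         suc-injective; 0≢1+n; ≡-irrelevant; +-identityʳ; +-assoc; *-zeroʳ; *-distribˡ-+; m+n∸m≡n)
open import Data.Product using (Σ; ∃; _×_; _,_; proj₁; proj₂)
open import Data.Sum using (_⊎_; inj₁; inj₂; [_,_]′)
open import Data.Vec as Vec using (Vec; []; _∷_; lookup; zipWith; reverse; _∷ʳ_; tabulate)
open import Data.Vec.Properties
  using (last-∷ʳ; reverse-∷; lookup-zipWith; lookup-map; lookup∘tabulate; tabulate∘lookup; tabulate-cong;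
         ∷-injectiveˡ; ∷-injectiveʳ)
open import Function using (_∘_; _⇔_; mk⇔)
open import Level using (0ℓ)
open import Relation.Binary.Definitions using (tri<; tri≈; tri>)
open import Relation.Binary.PropositionalEquality
  using (_≡_; _≢_; refl; sym; trans; cong; cong₂; subst; subst₂; module ≡-Reasoning)
open import Relation.Nullary using (¬_; Dec; yes; no)
open import Relation.Nullary.Decidable using (_×-dec_)
open import Relation.Unary using (Pred; Decidable)

open ≡-Reasoning

module _ {A B : Set} where

  ∈-concatMap⁺′ : ∀ (f : A → List B) {x xs z} → z ∈ f x → x ∈ xs → z ∈ concatMap f xs
  ∈-concatMap⁺′ f z∈fx x∈xs = ∈-concat⁺′ z∈fx (∈-map⁺ f x∈xs)

  ∈-concatMap⁻′ : ∀ (f : A → List B) xs {z} → z ∈ concatMap f xs →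
                  ∃ λ x → x ∈ xs × z ∈ f x
  ∈-concatMap⁻′ f xs = find ∘ ∈-concatMap⁻ f {xs = xs}

  concatMap⁺ : ∀ {f : A → List B} {xs} → Unique xs → (∀ x → Unique (f x)) →
               (∀ {x y z} → z ∈ f x → z ∈ f y → x ≡ y) → Unique (concatMap f xs)
  concatMap⁺ {f} {xs} xs! f! determined = concat⁺ (All.tabulate images!) (AllPairs.map⁺ (AllPairs.map disjoint xs!))
    where
    images! : ∀ {ys} → ys ∈ map f xs → Unique ys
    images! ys∈ with x , _ , refl ← ∈-map⁻ f ys∈ = f! x
    disjoint : ∀ {x y} → x ≢ y → ∀ {z} → ¬ (z ∈ f x × z ∈ f y)
    disjoint x≢y (z∈fx , z∈fy) = x≢y (determined z∈fx z∈fy)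

  length-concatMap : ∀ (f : A → List B) xs → length (concatMap f xs) ≡ sum (map (length ∘ f) xs)
  length-concatMap f []       = refl
  length-concatMap f (x ∷ xs) = trans (length-++ (f x)) (cong (length (f x) +_) (length-concatMap f xs))

sum-map-*ˡ : ∀ {A : Set} c (f : A → ℕ) xs → sum (map (λ x → c * f x) xs) ≡ c * sum (map f xs)
sum-map-*ˡ c f []       = sym (*-zeroʳ c)
sum-map-*ˡ c f (x ∷ xs) = trans (cong (c * f x +_) (sum-map-*ˡ c f xs)) (sym (*-distribˡ-+ c (f x) _))

length-cartesianProductWith : ∀ {A B C : Set} (f : A → B → C) xs ys →
                              length (cartesianProductWith f xs ys) ≡ length xs * length ys
length-cartesianProductWith f []       ys = refl
length-cartesianProductWith f (x ∷ xs) ys =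
  trans (length-++ (map (f x) ys)) (cong₂ _+_ (length-map (f x) ys) (length-cartesianProductWith f xs ys))

unique-⇔-length : ∀ {A : Set} {xs ys : List A} → Unique xs → Unique ys →
                  (∀ {z} → z ∈ xs ⇔ z ∈ ys) → length xs ≡ length ys
unique-⇔-length xs! ys! xs⇔ys = ↭-length (∼bag⇒↭ (unique∧set⇒bag xs! ys! xs⇔ys))

tabulate-∷ʳ : ∀ {A : Set} {n} (f : Fin (suc n) → A) →
              tabulate f ≡ tabulate (f ∘ inject₁) ∷ʳ f (fromℕ n)
tabulate-∷ʳ {n = zero}  f = refl
tabulate-∷ʳ {n = suc n} f = cong (f Fin.zero ∷_) (tabulate-∷ʳ (f ∘ Fin.suc))

lookup-∷ʳ-inject₁ : ∀ {A : Set} {n} (xs : Vec A n) x i → lookup (xs ∷ʳ x) (inject₁ i) ≡ lookup xs i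
lookup-∷ʳ-inject₁ (_ ∷ _)  x Fin.zero    = refl
lookup-∷ʳ-inject₁ (_ ∷ xs) x (Fin.suc i) = lookup-∷ʳ-inject₁ xs x i

lookup-∷ʳ-fromℕ : ∀ {A : Set} {n} (xs : Vec A n) x → lookup (xs ∷ʳ x) (fromℕ n) ≡ x
lookup-∷ʳ-fromℕ []       x = refl
lookup-∷ʳ-fromℕ (_ ∷ xs) x = lookup-∷ʳ-fromℕ xs x

lookup-reverse-opposite : ∀ {A : Set} {n} (xs : Vec A n) i →
                          lookup (reverse xs) (opposite i) ≡ lookup xs i
lookup-reverse-opposite (x ∷ xs) Fin.zero = begin
  lookup (reverse (x ∷ xs)) (opposite Fin.zero) ≡⟨ cong (λ v → lookup v _) (reverse-∷ x xs) ⟩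
  lookup (reverse xs ∷ʳ x) (fromℕ _)            ≡⟨ lookup-∷ʳ-fromℕ (reverse xs) x ⟩
  x                                             ∎
lookup-reverse-opposite (x ∷ xs) (Fin.suc i) = begin
  lookup (reverse (x ∷ xs)) (opposite (Fin.suc i)) ≡⟨ cong (λ v → lookup v _) (reverse-∷ x xs) ⟩
  lookup (reverse xs ∷ʳ x) (inject₁ (opposite i))  ≡⟨ lookup-∷ʳ-inject₁ (reverse xs) x (opposite i) ⟩
  lookup (reverse xs) (opposite i)                 ≡⟨ lookup-reverse-opposite xs i ⟩
  lookup xs i                                      ∎

lookup-reverse : ∀ {A : Set} {n} (xs : Vec A n) i → lookup (reverse xs) i ≡ lookup xs (opposite i)
lookup-reverse xs i = begin
  lookup (reverse xs) i                       ≡⟨ cong (lookup (reverse xs)) (opposite-involutive i) ⟨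
  lookup (reverse xs) (opposite (opposite i)) ≡⟨ lookup-reverse-opposite xs (opposite i) ⟩
  lookup xs (opposite i)                      ∎

lookupℕ : ∀ {A : Set} {m} → A → Vec A m → ℕ → A
lookupℕ d []       _       = d
lookupℕ d (a ∷ _)  zero    = a
lookupℕ d (_ ∷ as) (suc i) = lookupℕ d as i

lookupℕ-toℕ : ∀ {A : Set} {m} d (as : Vec A m) i → lookupℕ d as (toℕ i) ≡ lookup as i
lookupℕ-toℕ d (a ∷ _)  Fin.zero    = refl
lookupℕ-toℕ d (_ ∷ as) (Fin.suc i) = lookupℕ-toℕ d as i

-- The super Catalan recurrence

private
  S : ℕ → ℕ
  S = superCatalan

superCatalanUpTo-tabulate : ∀ n → superCatalanUpTo n ≡ tabulate (S ∘ toℕ)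
superCatalanUpTo-tabulate zero    = refl
superCatalanUpTo-tabulate (suc n) = begin
  v ∷ʳ y                                                  ≡⟨ cong₂ _∷ʳ_ prefix (sym (last-∷ʳ y v)) ⟩
  tabulate (S ∘ toℕ ∘ inject₁) ∷ʳ S (suc n)
    ≡⟨ cong (λ m → tabulate (S ∘ toℕ ∘ inject₁) ∷ʳ S m) (toℕ-fromℕ (suc n)) ⟨
  tabulate (S ∘ toℕ ∘ inject₁) ∷ʳ S (toℕ (fromℕ (suc n))) ≡⟨ tabulate-∷ʳ (S ∘ toℕ) ⟨
  tabulate (S ∘ toℕ)                                      ∎
  where
  v = superCatalanUpTo n
  y = 2 * Vec.sum (zipWith _*_ v (reverse v)) ∸ Vec.last v
  prefix : v ≡ tabulate (S ∘ toℕ ∘ inject₁)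
  prefix = trans (superCatalanUpTo-tabulate n) (tabulate-cong (cong S ∘ sym ∘ toℕ-inject₁))

lookup-superCatalanUpTo : ∀ n i → lookup (superCatalanUpTo n) i ≡ S (toℕ i)
lookup-superCatalanUpTo n i =
  trans (cong (λ v → lookup v i) (superCatalanUpTo-tabulate n)) (lookup∘tabulate (S ∘ toℕ) i)

superCatalanUpTo-convolution : ∀ n → zipWith _*_ (superCatalanUpTo n) (reverse (superCatalanUpTo n))
                                    ≡ tabulate (λ (i : Fin (suc n)) → S (toℕ i) * S (n ∸ toℕ i))
superCatalanUpTo-convolution n = trans (sym (tabulate∘lookup _)) (tabulate-cong entry)
  where
  v = superCatalanUpTo n
  entry : ∀ i → lookup (zipWith _*_ v (reverse v)) i ≡ S (toℕ i) * S (n ∸ toℕ i)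
  entry i = begin
    lookup (zipWith _*_ v (reverse v)) i ≡⟨ lookup-zipWith _*_ i v (reverse v) ⟩
    lookup v i * lookup (reverse v) i    ≡⟨ cong (lookup v i *_) (lookup-reverse v i) ⟩
    lookup v i * lookup v (opposite i)   ≡⟨ cong₂ _*_ (lookup-superCatalanUpTo n i)
                                                       (lookup-superCatalanUpTo n (opposite i)) ⟩
    S (toℕ i) * S (toℕ (opposite i))     ≡⟨ cong (λ m → S (toℕ i) * S m) (opposite-prop i) ⟩
    S (toℕ i) * S (n ∸ toℕ i)            ∎

Split : ℕ → Set
Split m = Σ ℕ λ j → Σ ℕ λ k → suc (suc j) + k ≡ m

shiftSplit : ∀ {m} → Split m → Split (suc m)
shiftSplit (j , k , e) = suc j , k , cong suc e

splits : (m : ℕ) → List (Split m)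
splits zero          = []
splits (suc zero)    = []
splits (suc (suc k)) = (0 , k , refl) ∷ map shiftSplit (splits (suc k))

sumOverSplits : ∀ m → (ℕ → ℕ → ℕ) → ℕ
sumOverSplits m f = sum (map (λ (j , k , _) → f j k) (splits m))

sumOverSplits-tabulate : ∀ n f → sumOverSplits (suc n) f
                                 ≡ Vec.sum (tabulate (λ (i : Fin n) → f (toℕ i) (n ∸ suc (toℕ i))))
sumOverSplits-tabulate zero    f = refl
sumOverSplits-tabulate (suc n) f = cong (f 0 n +_)
  (trans (cong sum (sym (map-∘ (splits (suc n))))) (sumOverSplits-tabulate n (λ j k → f (suc j) k)))

2*[m+n]∸m≡m+2*n : ∀ m n → 2 * (m + n) ∸ m ≡ m + 2 * n
2*[m+n]∸m≡m+2*n m n = begin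
  2 * (m + n) ∸ m         ≡⟨ cong (_∸ m) (*-distribˡ-+ 2 m n) ⟩
  m + (m + 0) + 2 * n ∸ m ≡⟨ cong (λ k → m + k + 2 * n ∸ m) (+-identityʳ m) ⟩
  m + m + 2 * n ∸ m       ≡⟨ cong (_∸ m) (+-assoc m m (2 * n)) ⟩
  m + (m + 2 * n) ∸ m     ≡⟨ m+n∸m≡n m (m + 2 * n) ⟩
  m + 2 * n               ∎

superCatalan-suc : ∀ n → S (suc n) ≡ S n + 2 * sumOverSplits (suc n) (λ j k → S (suc j) * S k)
superCatalan-suc n = begin
  S (suc n)                                     ≡⟨ last-∷ʳ _ v ⟩
  2 * Vec.sum (zipWith _*_ v (reverse v)) ∸ S n ≡⟨ cong (λ c → 2 * c ∸ S n) convolution ⟩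
  2 * (S n + X) ∸ S n                           ≡⟨ 2*[m+n]∸m≡m+2*n (S n) X ⟩
  S n + 2 * X                                   ∎
  where
  v = superCatalanUpTo n
  X = sumOverSplits (suc n) (λ j k → S (suc j) * S k)
  term : Fin n → ℕ
  term i = S (suc (toℕ i)) * S (n ∸ suc (toℕ i))
  convolution : Vec.sum (zipWith _*_ v (reverse v)) ≡ S n + X
  convolution = begin
    Vec.sum (zipWith _*_ v (reverse v)) ≡⟨ cong Vec.sum (superCatalanUpTo-convolution n) ⟩
    S 0 * S n + Vec.sum (tabulate term) ≡⟨ cong₂ _+_ (+-identityʳ (S n))
                                                      (sym (sumOverSplits-tabulate n (λ j k → S (suc j) * S k))) ⟩
    S n + X                             ∎

-- Tree m p codes the structures in Ω_pos(m) whose block of 0 has U-parity p (true meaning odd).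
-- In single p t, position 0 is a singleton block, with letter U iff p, and t codes positions 1, …, m − 1.
-- In join p j k _ b g a, the block of 0 has largest element J = suc j, with letter U iff b; g codes [0, J),
-- where the block of 0 lacks J and so has parity p xor b, and a codes (J, m).
data Tree : ℕ → Bool → Set where
  nil    : Tree 0 false
  single : ∀ {n} p → Tree n false → Tree (suc n) p
  join   : ∀ {m} p j k → suc (suc j) + k ≡ m → (b : Bool) →
           Tree (suc j) (p xor b) → Tree k false → Tree m p

split-≤ˡ : ∀ {j k n} → suc (suc j) + k ≡ suc n → suc j ≤ n
split-≤ˡ {j} {k} refl = m≤m+n (suc j) k

split-≤ʳ : ∀ {j k n} → suc (suc j) + k ≡ suc n → k ≤ n
split-≤ʳ {j} {k} refl = m≤n+m k (suc j)

split-< : ∀ j k {m} → suc (suc j) + k ≡ m → suc j < m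
split-< j k refl = m≤m+n (suc (suc j)) k

-- The first argument is fuel for the strong recursion; it only has to be at least n.
mutual
  trees≤ : ℕ → (n : ℕ) (p : Bool) → List (Tree n p)
  trees≤ _       zero    false = nil ∷ []
  trees≤ _       zero    true  = []
  trees≤ zero    (suc n) p     = []
  trees≤ (suc f) (suc n) p     =
    map (single p) (trees≤ f n false) ++ concatMap (joins f p) (splits (suc n))

  joins : ∀ {m} → ℕ → (p : Bool) → Split m → List (Tree m p)
  joins f p (j , k , e) = concatMap (joinsVia f p j k e) allBools

  joinsVia : ∀ {m} → ℕ → (p : Bool) (j k : ℕ) → suc (suc j) + k ≡ m → Bool → List (Tree m p)
  joinsVia f p j k e b =
    cartesianProductWith (join p j k e b) (trees≤ f (suc j) (p xor b)) (trees≤ f k false)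

mutual
  length-trees≤-false : ∀ f n → n ≤ f → length (trees≤ f n false) ≡ S n
  length-trees≤-false f       zero    _  = refl
  length-trees≤-false (suc f) (suc n) n≤f = length-trees≤-suc (suc f) n false n≤f

  length-trees≤-suc : ∀ f n p → suc n ≤ f → length (trees≤ f (suc n) p) ≡ S (suc n)
  length-trees≤-suc (suc f) n p (s≤s n≤f) = begin
    length (map (single p) (trees≤ f n false) ++ concatMap (joins f p) (splits (suc n)))
      ≡⟨ length-++ (map (single p) (trees≤ f n false)) ⟩
    length (map (single p) (trees≤ f n false)) + length (concatMap (joins f p) (splits (suc n)))
      ≡⟨ cong₂ _+_ (trans (length-map (single p) (trees≤ f n false)) (length-trees≤-false f n n≤f))
                   (length-concatMap (joins f p) (splits (suc n))) ⟩
    S n + sum (map (length ∘ joins f p) (splits (suc n)))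
      ≡⟨ cong (λ xs → S n + sum xs) (map-cong length-joins (splits (suc n))) ⟩
    S n + sum (map (λ s → 2 * weight s) (splits (suc n)))
      ≡⟨ cong (S n +_) (sum-map-*ˡ 2 weight (splits (suc n))) ⟩
    S n + 2 * sumOverSplits (suc n) (λ j k → S (suc j) * S k)
      ≡⟨ superCatalan-suc n ⟨
    S (suc n) ∎
    where
    weight : Split (suc n) → ℕ
    weight (j , k , _) = S (suc j) * S k
    length-joinsVia : ∀ {j k} (e : suc (suc j) + k ≡ suc n) b → length (joinsVia f p j k e b) ≡ S (suc j) * S k
    length-joinsVia {j} {k} e b = begin
      length (joinsVia f p j k e b)
        ≡⟨ length-cartesianProductWith (join p j k e b) (trees≤ f (suc j) (p xor b)) (trees≤ f k false) ⟩
      length (trees≤ f (suc j) (p xor b)) * length (trees≤ f k false)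
        ≡⟨ cong₂ _*_ (length-trees≤-suc f j (p xor b) (≤-trans (split-≤ˡ e) n≤f))
                     (length-trees≤-false f k (≤-trans (split-≤ʳ e) n≤f)) ⟩
      S (suc j) * S k ∎
    length-joins : ∀ s → length (joins f p s) ≡ 2 * weight s
    length-joins (j , k , e) = trans (length-concatMap (joinsVia f p j k e) allBools)
      (cong₂ (λ x y → x + (y + 0)) (length-joinsVia e false) (length-joinsVia e true))

Split-≡ : ∀ {m} {s s′ : Split m} → proj₁ s ≡ proj₁ s′ → s ≡ s′
Split-≡ {s = j , k , e} {s′ = .j , k′ , e′} refl
  with refl ← +-cancelˡ-≡ (suc (suc j)) k k′ (trans e (sym e′))
  rewrite ≡-irrelevant e e′ = refl

splits⁺ : ∀ m → Unique (splits m)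
splits⁺ zero          = []
splits⁺ (suc zero)    = []
splits⁺ (suc (suc k)) = All-map⁺ (All.universal (λ s e → 0≢1+n (cong proj₁ e)) (splits (suc k)))
                      ∷ map⁺ (λ e → Split-≡ (suc-injective (cong proj₁ e))) (splits⁺ (suc k))

∈-splits : ∀ j k → (j , k , refl) ∈ splits (suc (suc j) + k)
∈-splits zero    k = here refl
∈-splits (suc j) k = there (∈-map⁺ shiftSplit (∈-splits j k))

∈-allBools : ∀ b → b ∈ allBools
∈-allBools false = here refl
∈-allBools true  = there (here refl)

allBools⁺ : Unique allBools
allBools⁺ = ((λ ()) All.∷ All.[]) ∷ All.[] ∷ []

join-injective : ∀ {m p j j′ k k′ b b′} {e : suc (suc j) + k ≡ m} {e′ : suc (suc j′) + k′ ≡ m}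
                   {g : Tree (suc j) (p xor b)} {g′ : Tree (suc j′) (p xor b′)}
                   {a : Tree k false} {a′ : Tree k′ false} →
                 join p j k e b g a ≡ join p j′ k′ e′ b′ g′ a′ →
                 (j , k , e) ≡ (j′ , k′ , e′) × b ≡ b′
join-injective refl = refl , refl

∈-joinsVia⁻ : ∀ f {m p j k e b} {t : Tree m p} → t ∈ joinsVia f p j k e b →
              ∃ λ g → ∃ λ a → t ≡ join p j k e b g a
∈-joinsVia⁻ f {p = p} {j} {k} {e} {b} t∈
  with g , a , _ , _ , t≡ ←
         ∈-cartesianProductWith⁻ (join p j k e b) (trees≤ f (suc j) (p xor b)) (trees≤ f k false) t∈
  = g , a , t≡

∈-joins⁻ : ∀ f {m p j k e} {t : Tree m p} → t ∈ joins f p (j , k , e) →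
           ∃ λ b → ∃ λ g → ∃ λ a → t ≡ join p j k e b g a
∈-joins⁻ f {p = p} {j} {k} {e} t∈ with b , _ , t∈′ ← ∈-concatMap⁻′ (joinsVia f p j k e) allBools t∈ =
  b , ∈-joinsVia⁻ f t∈′

trees≤⁺ : ∀ f n p → Unique (trees≤ f n p)
trees≤⁺ _       zero    false = All.[] ∷ []
trees≤⁺ _       zero    true  = []
trees≤⁺ zero    (suc n) p     = []
trees≤⁺ (suc f) (suc n) p     =
  ++⁺ (map⁺ single-injective (trees≤⁺ f n false))
      (concatMap⁺ (splits⁺ (suc n)) joins⁺ joins-disjoint)
      single∉joins
  where
  single-injective : ∀ {t t′ : Tree n false} → single p t ≡ single p t′ → t ≡ t′
  single-injective refl = refl
  joinsVia⁺ : ∀ {j k} (e : suc (suc j) + k ≡ suc n) b → Unique (joinsVia f p j k e b)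
  joinsVia⁺ {j} {k} e b = cartesianProductWith⁺ (join p j k e b) (λ { refl → refl , refl })
    (trees≤⁺ f (suc j) (p xor b)) (trees≤⁺ f k false)
  joins⁺ : ∀ s → Unique (joins f p s)
  joins⁺ (j , k , e) = concatMap⁺ allBools⁺ (joinsVia⁺ e) λ t∈ t∈′ →
    let _ , _ , t≡ = ∈-joinsVia⁻ f t∈; _ , _ , t≡′ = ∈-joinsVia⁻ f t∈′
    in  proj₂ (join-injective (trans (sym t≡) t≡′))
  joins-disjoint : ∀ {s s′ t} → t ∈ joins f p s → t ∈ joins f p s′ → s ≡ s′
  joins-disjoint t∈ t∈′ =
    let _ , _ , _ , t≡ = ∈-joins⁻ f t∈; _ , _ , _ , t≡′ = ∈-joins⁻ f t∈′
    in  proj₁ (join-injective (trans (sym t≡) t≡′))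
  single∉joins : ∀ {t} → ¬ (t ∈ map (single p) (trees≤ f n false) × t ∈ concatMap (joins f p) (splits (suc n)))
  single∉joins (t∈ , t∈′)
    with _ , _ , refl ← ∈-map⁻ (single p) t∈
       | _ , _ , t∈″ ← ∈-concatMap⁻′ (joins f p) (splits (suc n)) t∈′
    with _ , _ , _ , () ← ∈-joins⁻ f t∈″

∈-trees≤ : ∀ f {n p} (t : Tree n p) → n ≤ f → t ∈ trees≤ f n p
∈-trees≤ f       nil          _          = here refl
∈-trees≤ (suc f) (single p t) (s≤s n≤f) = ∈-++⁺ˡ (∈-map⁺ (single p) (∈-trees≤ f t n≤f))
∈-trees≤ (suc f) (join p j k refl b g a) (s≤s n≤f) =
  ∈-++⁺ʳ (map (single p) (trees≤ f (suc j + k) false))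
    (∈-concatMap⁺′ (joins f p)
      (∈-concatMap⁺′ (joinsVia f p j k refl)
        (∈-cartesianProductWith⁺ (join p j k refl b) g∈ a∈) (∈-allBools b))
      (∈-splits j k))
  where
  g∈ = ∈-trees≤ f g (≤-trans (split-≤ˡ refl) n≤f)
  a∈ = ∈-trees≤ f a (≤-trans (split-≤ʳ {j} refl) n≤f)

false≢true : false ≢ true
false≢true ()

label : Bool → Letter
label true  = U
label false = E

isU : Letter → Bool
isU U = true
isU _ = false

isU-label : ∀ b → isU (label b) ≡ b
isU-label true  = refl
isU-label false = refl

label-isU : ∀ {l} → l ≢ O → label (isU l) ≡ l
label-isU {O} l≢O = ⊥-elim (l≢O refl)
label-isU {U} _   = refl
label-isU {E} _   = refl

label≢O : ∀ b → label b ≢ O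
label≢O true  ()
label≢O false ()

label-injective : ∀ {b b′} → label b ≡ label b′ → b ≡ b′
label-injective {b} {b′} eq = trans (sym (isU-label b)) (trans (cong isU eq) (isU-label b′))

∧≡true⁺ : ∀ {a b} → a ≡ true → b ≡ true → a ∧ b ≡ true
∧≡true⁺ refl refl = refl

∧≡true⁻ : ∀ {a b} → a ∧ b ≡ true → a ≡ true × b ≡ true
∧≡true⁻ {true} {true} _ = refl , refl

isU≡true⇒≡U : ∀ {l} → isU l ≡ true → l ≡ U
isU≡true⇒≡U {U} _ = refl

xor-cancelʳ : ∀ p b → (p xor b) xor b ≡ p
xor-cancelʳ p b = trans (xor-assoc p b b) (trans (cong (p xor_) (xor-same b)) (xor-identityʳ p))

parity : ℕ → (ℕ → Bool) → Bool
parity zero    f = false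
parity (suc m) f = f 0 xor parity m (λ t → f (suc t))

parity-cong : ∀ m {f g : ℕ → Bool} → (∀ {t} → t < m → f t ≡ g t) → parity m f ≡ parity m g
parity-cong zero    f≗g = refl
parity-cong (suc m) f≗g = cong₂ _xor_ (f≗g (s≤s z≤n)) (parity-cong m (λ t<m → f≗g (s≤s t<m)))

parity-false : ∀ m {f : ℕ → Bool} → (∀ {t} → t < m → f t ≡ false) → parity m f ≡ false
parity-false zero    f≗false = refl
parity-false (suc m) f≗false = cong₂ _xor_ (f≗false (s≤s z≤n)) (parity-false m (λ t<m → f≗false (s≤s t<m)))

parity-+ : ∀ s n f → parity (s + n) f ≡ parity s f xor parity n (λ t → f (s + t))
parity-+ zero    n f = refl
parity-+ (suc s) n f = trans (cong (f 0 xor_) (parity-+ s n (λ t → f (suc t))))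
                             (sym (xor-assoc (f 0) (parity s (λ t → f (suc t))) _))

parity-suc : ∀ m f → parity (suc m) f ≡ parity m f xor f m
parity-suc zero    f = xor-identityʳ (f 0)
parity-suc (suc m) f = trans (cong (f 0 xor_) (parity-suc m (λ t → f (suc t))))
                             (sym (xor-assoc (f 0) (parity m (λ t → f (suc t))) (f (suc m))))

parity-only : ∀ m {i} f → i < m → (∀ {t} → t < m → t ≢ i → f t ≡ false) → parity m f ≡ f i
parity-only (suc m) {zero} f _ others =
  trans (cong (f 0 xor_) (parity-false m (λ t<m → others (s≤s t<m) λ ()))) (xor-identityʳ (f 0))
parity-only (suc m) {suc i} f (s≤s i<m) others =
  cong₂ _xor_ (others (s≤s z≤n) λ ())
              (parity-only m (λ t → f (suc t)) i<m (λ t<m t≢i → others (s≤s t<m) (t≢i ∘ suc-injective)))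

data Side (s : ℕ) : ℕ → Set where
  left  : ∀ {i} → i < s → Side s i
  right : ∀ i → Side s (s + i)

side : ∀ s i → Side s i
side zero    i       = right i
side (suc s) zero    = left (s≤s z≤n)
side (suc s) (suc i) with side s i
... | left i<s = left (s≤s i<s)
... | right i′ = right i′

side-left : ∀ {s i} (i<s : i < s) → side s i ≡ left i<s
side-left {suc s} {zero}  (s≤s z≤n) = refl
side-left {suc s} {suc i} (s≤s i<s) rewrite side-left i<s = refl

side-right : ∀ s i → side s (s + i) ≡ right i
side-right zero    i = refl
side-right (suc s) i rewrite side-right s i = refl

m+n<o⇒o≰m : ∀ {m n o} → m + n < o → o ≤ m → ⊥
m+n<o⇒o≰m {m} m+n<o o≤m = <⇒≱ (<-≤-trans m+n<o o≤m) (m≤m+n m _)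

_++⟨_⟩_ : ∀ {A : Set} → (ℕ → A) → ℕ → (ℕ → A) → ℕ → A
(f ++⟨ s ⟩ g) i with side s i
... | left _   = f i
... | right i′ = g i′

module _ {A : Set} (f g : ℕ → A) where

  ++-left : ∀ {s i} → i < s → (f ++⟨ s ⟩ g) i ≡ f i
  ++-left i<s rewrite side-left i<s = refl

  ++-right : ∀ s i → (f ++⟨ s ⟩ g) (s + i) ≡ g i
  ++-right s i rewrite side-right s i = refl

  ++-at : ∀ s → (f ++⟨ s ⟩ g) s ≡ g 0
  ++-at s = subst (λ i → (f ++⟨ s ⟩ g) i ≡ g 0) (+-identityʳ s) (++-right s 0)

collapse : ℕ → ℕ → ℕ
collapse J = (λ i → i) ++⟨ J ⟩ (λ _ → 0)

collapse-left : ∀ {J i} → i < J → collapse J i ≡ i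
collapse-left = ++-left (λ i → i) (λ _ → 0)

collapse-at : ∀ J → collapse J J ≡ 0
collapse-at = ++-at (λ i → i) (λ _ → 0)

collapse-< : ∀ {j i} → i < suc (suc j) → collapse (suc j) i < suc j
collapse-< {j} {i} i< with side (suc j) i
... | left i<J = i<J
... | right _  = s≤s z≤n

true⇔⇒≡ : ∀ {a b} → (a ≡ true → b ≡ true) → (b ≡ true → a ≡ true) → a ≡ b
true⇔⇒≡ {false} {false} _   _   = refl
true⇔⇒≡ {false} {true}  _   b⇒a = b⇒a refl
true⇔⇒≡ {true}  {false} a⇒b _   = sym (a⇒b refl)
true⇔⇒≡ {true}  {true}  _   _   = refl

record IsEquivalenceOn {A : Set} (D : A → Set) (r : A → A → Bool) : Set where
  field
    reflexive  : ∀ {i} → D i → r i i ≡ true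
    symmetric  : ∀ {i j} → D i → D j → r i j ≡ true → r j i ≡ true
    transitive : ∀ {i j l} → D i → D j → D l → r i j ≡ true → r j l ≡ true → r i l ≡ true

  symmetric-≡ : ∀ {i j} → D i → D j → r i j ≡ r j i
  symmetric-≡ Di Dj = true⇔⇒≡ (symmetric Di Dj) (symmetric Dj Di)

  congˡ : ∀ {i j l} → D i → D j → D l → r i j ≡ true → r i l ≡ r j l
  congˡ Di Dj Dl rij = true⇔⇒≡ (transitive Dj Di Dl (symmetric Di Dj rij)) (transitive Di Dj Dl rij)

  congʳ : ∀ {i j l} → D i → D j → D l → r i j ≡ true → r l i ≡ r l j
  congʳ Di Dj Dl rij = trans (symmetric-≡ Dl Di) (trans (congˡ Di Dj Dl rij) (symmetric-≡ Dj Dl))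

pullback : ∀ {A B : Set} {D : A → Set} {D′ : B → Set} {r : A → A → Bool} (σ : B → A) →
           IsEquivalenceOn D r → (∀ {i} → D′ i → D (σ i)) → IsEquivalenceOn D′ (λ i j → r (σ i) (σ j))
pullback σ eq σ∈D = record
  { reflexive  = λ Di → reflexive (σ∈D Di)
  ; symmetric  = λ Di Dj → symmetric (σ∈D Di) (σ∈D Dj)
  ; transitive = λ Di Dj Dl → transitive (σ∈D Di) (σ∈D Dj) (σ∈D Dl)
  }
  where open IsEquivalenceOn eq

⊎-rel : ∀ {A B : Set} → (A → A → Bool) → (B → B → Bool) → A ⊎ B → A ⊎ B → Bool
⊎-rel r q (inj₁ i) (inj₁ j) = r i j
⊎-rel r q (inj₁ i) (inj₂ j) = false
⊎-rel r q (inj₂ i) (inj₁ j) = false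
⊎-rel r q (inj₂ i) (inj₂ j) = q i j

⊎-isEquivalenceOn : ∀ {A B : Set} {D₁ : A → Set} {D₂ : B → Set} {r q} →
                    IsEquivalenceOn D₁ r → IsEquivalenceOn D₂ q → IsEquivalenceOn [ D₁ , D₂ ]′ (⊎-rel r q)
⊎-isEquivalenceOn {D₁ = D₁} {D₂} {r} {q} eq₁ eq₂ = record
  { reflexive = λ {i} → rfl {i} ; symmetric = λ {i j} → sm {i} {j} ; transitive = λ {i j l} → tr {i} {j} {l} }
  where
  module E₁ = IsEquivalenceOn eq₁
  module E₂ = IsEquivalenceOn eq₂
  D = [ D₁ , D₂ ]′
  rfl : ∀ {i} → D i → ⊎-rel r q i i ≡ true
  rfl {inj₁ _} = E₁.reflexive
  rfl {inj₂ _} = E₂.reflexive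
  sm : ∀ {i j} → D i → D j → ⊎-rel r q i j ≡ true → ⊎-rel r q j i ≡ true
  sm {inj₁ _} {inj₁ _} = E₁.symmetric
  sm {inj₂ _} {inj₂ _} = E₂.symmetric
  sm {inj₁ _} {inj₂ _} _ _ ()
  sm {inj₂ _} {inj₁ _} _ _ ()
  tr : ∀ {i j l} → D i → D j → D l → ⊎-rel r q i j ≡ true → ⊎-rel r q j l ≡ true → ⊎-rel r q i l ≡ true
  tr {inj₁ _} {inj₁ _} {inj₁ _} = E₁.transitive
  tr {inj₂ _} {inj₂ _} {inj₂ _} = E₂.transitive
  tr {inj₁ _} {inj₂ _} {_}      _ _ _ ()
  tr {inj₂ _} {inj₁ _} {_}      _ _ _ ()
  tr {inj₁ _} {inj₁ _} {inj₂ _} _ _ _ _ ()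
  tr {inj₂ _} {inj₂ _} {inj₁ _} _ _ _ _ ()

part : ℕ → ℕ → ℕ ⊎ ℕ
part s = inj₁ ++⟨ s ⟩ inj₂

_⊕⟨_⟩_ : (ℕ → ℕ → Bool) → ℕ → (ℕ → ℕ → Bool) → ℕ → ℕ → Bool
(r ⊕⟨ s ⟩ q) i j = ⊎-rel r q (part s i) (part s j)

module _ (r q : ℕ → ℕ → Bool) {s : ℕ} where

  ⊕-ll : ∀ {i j} → i < s → j < s → (r ⊕⟨ s ⟩ q) i j ≡ r i j
  ⊕-ll i<s j<s = cong₂ (⊎-rel r q) (++-left inj₁ inj₂ i<s) (++-left inj₁ inj₂ j<s)

  ⊕-rr : ∀ i j → (r ⊕⟨ s ⟩ q) (s + i) (s + j) ≡ q i j
  ⊕-rr i j = cong₂ (⊎-rel r q) (++-right inj₁ inj₂ s i) (++-right inj₁ inj₂ s j)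

  ⊕-lr : ∀ {i j} → i < s → s ≤ j → (r ⊕⟨ s ⟩ q) i j ≡ false
  ⊕-lr {i} {j} i<s s≤j with side s j
  ... | left j<s = ⊥-elim (<⇒≱ j<s s≤j)
  ... | right j′ = cong (λ z → ⊎-rel r q z (inj₂ j′)) (++-left inj₁ inj₂ i<s)

  ⊕-rl : ∀ {i j} → s ≤ i → j < s → (r ⊕⟨ s ⟩ q) i j ≡ false
  ⊕-rl {i} {j} s≤i j<s with side s i
  ... | left i<s = ⊥-elim (<⇒≱ i<s s≤i)
  ... | right i′ = cong (λ z → ⊎-rel r q (inj₂ i′) z) (++-left inj₁ inj₂ j<s)

-- attach J r puts J into the block of 0 of r; positions after J are junk.
attach : ℕ → (ℕ → ℕ → Bool) → ℕ → ℕ → Bool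
attach J r i j = r (collapse J i) (collapse J j)

-- Structures on positions

-- Valid m p x r: restricted to [0, m), the letters x and the same-block relation r form an element
-- of Ω_pos(m), except that the block of 0 has U-parity p. Singleton blocks need no condition: a
-- singleton block with letter U has odd parity.
record Valid (m : ℕ) (p : Bool) (x : ℕ → Letter) (r : ℕ → ℕ → Bool) : Set where
  field
    isEquivalence : IsEquivalenceOn (_< m) r
    noncrossing   : ∀ {a b c d} → a < b → b < c → c < d → d < m →
                    r a c ≡ true → r b d ≡ true → r a b ≡ false → ⊥
    nonzero       : ∀ {i} → i < m → x i ≢ O
    parity-block  : ∀ {i} → i < m → parity m (λ l → r i l ∧ isU (x l)) ≡ r i 0 ∧ p

  open IsEquivalenceOn isEquivalence public

Closed : ℕ → ℕ → (ℕ → ℕ → Bool) → Set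
Closed s m r = ∀ {i l} → i < s → s ≤ l → l < m → r i l ≡ false

module _ {m p x r} (V : Valid m p x r) where
  private module V = Valid V

  -- Unless a lies in the block of 0 = the block of b, (0, a, b, c) is a crossing.
  noncrossing-first : ∀ {a b c} → a < b → b < c → c < m →
                      r a c ≡ true → r b 0 ≡ true → r a b ≡ false → ⊥
  noncrossing-first {zero} a<b b<c c<m rac rb0 rab = false≢true (trans (sym rab) (V.symmetric b<m 0<m rb0))
    where
    b<m = <-trans b<c c<m
    0<m = <-trans a<b b<m
  noncrossing-first {suc a} {b} {c} a<b b<c c<m rac rb0 rab with r 0 (suc a) in r0a
  ... | true  = false≢true (trans (sym rab)
                  (V.transitive a<m 0<m b<m (V.symmetric 0<m a<m r0a) (V.symmetric b<m 0<m rb0)))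
    where
    b<m = <-trans b<c c<m
    a<m = <-trans a<b b<m
    0<m = ≤-<-trans z≤n a<m
  ... | false = V.noncrossing (s≤s z≤n) a<b b<c c<m (V.symmetric b<m 0<m rb0) rac r0a
    where
    b<m = <-trans b<c c<m
    0<m = ≤-<-trans z≤n b<m

  -- A block meeting both sides of J would cross the block of 0, whose largest element is J.
  closed-after-last : ∀ {J} → J < m → r 0 J ≡ true → (∀ {l} → J < l → l < m → r 0 l ≡ false) →
                      Closed (suc J) m r
  closed-after-last {J} J<m r0J last {i} {l} i<1+J J<l l<m with r i l in ril | r 0 i in r0i
  ... | false | _     = refl
  ... | true  | true  = ⊥-elim (false≢true (trans (sym (last J<l l<m)) (V.transitive 0<m i<m l<m r0i ril)))
    where
    0<m = ≤-<-trans z≤n J<m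
    i<m = ≤-<-trans (≤-pred i<1+J) J<m
  ... | true  | false with m<1+n⇒m<n∨m≡n i<1+J
  ...   | inj₂ refl = ⊥-elim (false≢true (trans (sym r0i) r0J))
  ...   | inj₁ i<J  = ⊥-elim (V.noncrossing (0<i i r0i) i<J J<l l<m r0J ril r0i)
    where
    0<i : ∀ i → r 0 i ≡ false → 0 < i
    0<i zero    r00 = ⊥-elim (false≢true (trans (sym r00) (V.reflexive (≤-<-trans z≤n J<m))))
    0<i (suc i) _   = s≤s z≤n

Valid-empty : ∀ {x r} → Valid 0 false x r
Valid-empty = record
  { isEquivalence = record { reflexive = λ () ; symmetric = λ () ; transitive = λ () }
  ; noncrossing   = λ _ _ _ ()
  ; nonzero       = λ ()
  ; parity-block  = λ ()
  }

Valid-singleton : ∀ p → Valid 1 p (λ _ → label p) (λ _ _ → true)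
Valid-singleton p = record
  { isEquivalence = record
    { reflexive = λ _ → refl ; symmetric = λ _ _ _ → refl ; transitive = λ _ _ _ _ _ → refl }
  ; noncrossing   = λ { _ _ () (s≤s z≤n) }
  ; nonzero       = λ _ → label≢O p
  ; parity-block  = λ _ → trans (xor-identityʳ (isU (label p))) (isU-label p)
  }

module _ {s n : ℕ} {x y : ℕ → Letter} {r q : ℕ → ℕ → Bool} where

  parity-⊕-left : ∀ {i} → i < s → parity (s + n) (λ l → (r ⊕⟨ s ⟩ q) i l ∧ isU ((x ++⟨ s ⟩ y) l))
                                   ≡ parity s (λ l → r i l ∧ isU (x l))
  parity-⊕-left {i} i<s = begin
    parity (s + n) F                             ≡⟨ parity-+ s n F ⟩
    parity s F xor parity n (λ t → F (s + t))    ≡⟨ cong₂ _xor_ (parity-cong s inside) (parity-false n outside) ⟩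
    parity s (λ l → r i l ∧ isU (x l)) xor false ≡⟨ xor-identityʳ _ ⟩
    parity s (λ l → r i l ∧ isU (x l))           ∎
    where
    F = λ l → (r ⊕⟨ s ⟩ q) i l ∧ isU ((x ++⟨ s ⟩ y) l)
    inside : ∀ {l} → l < s → F l ≡ r i l ∧ isU (x l)
    inside l<s = cong₂ (λ b l → b ∧ isU l) (⊕-ll r q i<s l<s) (++-left x y l<s)
    outside : ∀ {t} → t < n → F (s + t) ≡ false
    outside {t} _ = cong (_∧ isU ((x ++⟨ s ⟩ y) (s + t))) (⊕-lr r q i<s (m≤m+n s t))

  parity-⊕-right : ∀ i → parity (s + n) (λ l → (r ⊕⟨ s ⟩ q) (s + i) l ∧ isU ((x ++⟨ s ⟩ y) l))
                         ≡ parity n (λ l → q i l ∧ isU (y l))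
  parity-⊕-right i = begin
    parity (s + n) F                          ≡⟨ parity-+ s n F ⟩
    parity s F xor parity n (λ t → F (s + t)) ≡⟨ cong₂ _xor_ (parity-false s outside) (parity-cong n inside) ⟩
    parity n (λ l → q i l ∧ isU (y l))        ∎
    where
    F = λ l → (r ⊕⟨ s ⟩ q) (s + i) l ∧ isU ((x ++⟨ s ⟩ y) l)
    outside : ∀ {l} → l < s → F l ≡ false
    outside {l} l<s = cong (_∧ isU ((x ++⟨ s ⟩ y) l)) (⊕-rl r q (m≤m+n s i) l<s)
    inside : ∀ {t} → t < n → F (s + t) ≡ q i t ∧ isU (y t)
    inside {t} _ = cong₂ (λ b l → b ∧ isU l) (⊕-rr r q {s = s} i t) (++-right x y s t)

module _ {s n p x y r q} (0<s : 0 < s) (V₁ : Valid s p x r) (V₂ : Valid n false y q) where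
  private
    module V₁ = Valid V₁
    module V₂ = Valid V₂
    r⊕q = r ⊕⟨ s ⟩ q
    x++y = x ++⟨ s ⟩ y

    part-bounded : ∀ {i} → i < s + n → [ _< s , _< n ]′ (part s i)
    part-bounded {i} i< with side s i
    ... | left i<s = i<s
    ... | right i′ = +-cancelˡ-< s i′ n i<

    noncrossing : ∀ {a b c d} → a < b → b < c → c < d → d < s + n →
                  r⊕q a c ≡ true → r⊕q b d ≡ true → r⊕q a b ≡ false → ⊥
    noncrossing {a} {b} {c} {d} a<b b<c c<d d< rac rbd rab with side s a | side s b | side s c | side s d
    ... | left _  | left _  | left _  | left d<s = V₁.noncrossing a<b b<c c<d d<s rac rbd rab
    ... | left _  | left _  | left _  | right _  = false≢true rbd
    ... | left _  | _       | right _ | _        = false≢true rac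
    ... | _       | right _ | left c<s | _       = m+n<o⇒o≰m b<c (<⇒≤ c<s)
    ... | right _ | left b<s | _      | _        = m+n<o⇒o≰m a<b (<⇒≤ b<s)
    ... | right _ | right _ | right _ | left d<s = m+n<o⇒o≰m c<d (<⇒≤ d<s)
    ... | right a′ | right b′ | right c′ | right d′ =
      V₂.noncrossing (+-cancelˡ-< s a′ b′ a<b) (+-cancelˡ-< s b′ c′ b<c) (+-cancelˡ-< s c′ d′ c<d)
                     (+-cancelˡ-< s d′ n d<) rac rbd rab

    nonzero : ∀ {i} → i < s + n → x++y i ≢ O
    nonzero {i} i< with side s i
    ... | left i<s = V₁.nonzero i<s
    ... | right i′ = V₂.nonzero (+-cancelˡ-< s i′ n i<)

    parity-block : ∀ {i} → i < s + n → parity (s + n) (λ l → r⊕q i l ∧ isU (x++y l)) ≡ r⊕q i 0 ∧ p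
    parity-block {i} i< = parity-at (side s i) i<
      where
      parity-at : ∀ {i} → Side s i → i < s + n → parity (s + n) (λ l → r⊕q i l ∧ isU (x++y l)) ≡ r⊕q i 0 ∧ p
      parity-at {i} (left i<s) _ = begin
        parity (s + n) (λ l → r⊕q i l ∧ isU (x++y l)) ≡⟨ parity-⊕-left {n = n} i<s ⟩
        parity s (λ l → r i l ∧ isU (x l))            ≡⟨ V₁.parity-block i<s ⟩
        r i 0 ∧ p                                     ≡⟨ cong (_∧ p) (⊕-ll r q i<s 0<s) ⟨
        r⊕q i 0 ∧ p                                   ∎
      parity-at (right i′) i< = begin
        parity (s + n) (λ l → r⊕q (s + i′) l ∧ isU (x++y l)) ≡⟨ parity-⊕-right {s} {n} i′ ⟩
        parity n (λ l → q i′ l ∧ isU (y l))                  ≡⟨ V₂.parity-block (+-cancelˡ-< s i′ n i<) ⟩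
        q i′ 0 ∧ false                                       ≡⟨ ∧-zeroʳ (q i′ 0) ⟩
        false                                                ≡⟨ cong (_∧ p) (⊕-rl r q (m≤m+n s i′) 0<s) ⟨
        r⊕q (s + i′) 0 ∧ p                                   ∎

  Valid-++ : Valid (s + n) p x++y r⊕q
  Valid-++ = record
    { isEquivalence = pullback (part s) (⊎-isEquivalenceOn V₁.isEquivalence V₂.isEquivalence) part-bounded
    ; noncrossing   = noncrossing
    ; nonzero       = nonzero
    ; parity-block  = parity-block
    }

module _ {j q x r} (V : Valid (suc j) q x r) (b : Bool) where
  private
    module V = Valid V
    J = suc j
    x′ = x ++⟨ J ⟩ (λ _ → label b)

    noncrossing : ∀ {a b c d} → a < b → b < c → c < d → d < suc J →
                  attach J r a c ≡ true → attach J r b d ≡ true → attach J r a b ≡ false → ⊥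
    noncrossing {a} {b} {c} {d} a<b b<c c<d d< rac rbd rab with side J a | side J b | side J c | side J d
    ... | left _  | left _   | left _   | left d<J = V.noncrossing a<b b<c c<d d<J rac rbd rab
    ... | left _  | left _   | left c<J | right _  = noncrossing-first V a<b b<c c<J rac rbd rab
    ... | _       | _        | right _  | _        = m+n<o⇒o≰m c<d (≤-pred d<)
    ... | _       | right _  | left c<J | _        = m+n<o⇒o≰m b<c (<⇒≤ c<J)
    ... | right _ | left b<J | _        | _        = m+n<o⇒o≰m a<b (<⇒≤ b<J)

    nonzero : ∀ {i} → i < suc J → x′ i ≢ O
    nonzero {i} i< with side J i
    ... | left i<J = V.nonzero i<J
    ... | right _  = label≢O b

    parity-block : ∀ {i} → i < suc J →
                   parity (suc J) (λ l → attach J r i l ∧ isU (x′ l)) ≡ attach J r i 0 ∧ (q xor b)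
    parity-block {i} i< = begin
      parity (suc J) F                                     ≡⟨ parity-suc J F ⟩
      parity J F xor F J                                   ≡⟨ cong₂ _xor_ (parity-cong J below) at-J ⟩
      parity J (λ l → r i₀ l ∧ isU (x l)) xor (r i₀ 0 ∧ b) ≡⟨ cong (_xor (r i₀ 0 ∧ b))
                                                                   (V.parity-block (collapse-< i<)) ⟩
      (r i₀ 0 ∧ q) xor (r i₀ 0 ∧ b)                        ≡⟨ ∧-distribˡ-xor (r i₀ 0) q b ⟨
      r i₀ 0 ∧ (q xor b)                                   ∎
      where
      i₀ = collapse J i
      F = λ l → attach J r i l ∧ isU (x′ l)
      below : ∀ {l} → l < J → F l ≡ r i₀ l ∧ isU (x l)
      below l<J = cong₂ (λ l′ y → r i₀ l′ ∧ isU y) (collapse-left l<J) (++-left x (λ _ → label b) l<J)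
      at-J : F J ≡ r i₀ 0 ∧ b
      at-J = trans (cong₂ (λ l′ y → r i₀ l′ ∧ isU y) (collapse-at J) (++-at x (λ _ → label b) J))
                   (cong (r i₀ 0 ∧_) (isU-label b))

  Valid-attach : Valid (suc J) (q xor b) x′ (attach J r)
  Valid-attach = record
    { isEquivalence = pullback (collapse J) V.isEquivalence collapse-<
    ; noncrossing   = noncrossing
    ; nonzero       = nonzero
    ; parity-block  = parity-block
    }

module _ {s n p x r} (V : Valid (s + n) p x r) (closed : Closed s (s + n) r) where
  private module V = Valid V

  closed-sym : ∀ {i l} → i < s → s ≤ l → l < s + n → r l i ≡ false
  closed-sym i<s s≤l l< = trans (V.symmetric-≡ l< (<-≤-trans i<s (m≤m+n s n))) (closed i<s s≤l l<)

  Valid-take : Valid s p x r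
  Valid-take = record
    { isEquivalence = pullback (λ i → i) V.isEquivalence inject
    ; noncrossing   = λ a<b b<c c<d d<s → V.noncrossing a<b b<c c<d (inject d<s)
    ; nonzero       = λ i<s → V.nonzero (inject i<s)
    ; parity-block  = parity-block
    }
    where
    inject : ∀ {i} → i < s → i < s + n
    inject i<s = <-≤-trans i<s (m≤m+n s n)
    parity-block : ∀ {i} → i < s → parity s (λ l → r i l ∧ isU (x l)) ≡ r i 0 ∧ p
    parity-block {i} i<s = begin
      parity s F                                ≡⟨ xor-identityʳ (parity s F) ⟨
      parity s F xor false                      ≡⟨ cong (parity s F xor_) (parity-false n tail-false) ⟨
      parity s F xor parity n (λ t → F (s + t)) ≡⟨ parity-+ s n F ⟨
      parity (s + n) F                          ≡⟨ V.parity-block (inject i<s) ⟩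
      r i 0 ∧ p                                 ∎
      where
      F = λ l → r i l ∧ isU (x l)
      tail-false : ∀ {t} → t < n → F (s + t) ≡ false
      tail-false {t} t<n = cong (_∧ isU (x (s + t))) (closed i<s (m≤m+n s t) (+-monoʳ-< s t<n))

  Valid-drop : 0 < s → Valid n false (λ i → x (s + i)) (λ i j → r (s + i) (s + j))
  Valid-drop 0<s = record
    { isEquivalence = pullback (s +_) V.isEquivalence (+-monoʳ-< s)
    ; noncrossing   = λ a<b b<c c<d d<n →
                        V.noncrossing (+-monoʳ-< s a<b) (+-monoʳ-< s b<c) (+-monoʳ-< s c<d) (+-monoʳ-< s d<n)
    ; nonzero       = λ i<n → V.nonzero (+-monoʳ-< s i<n)
    ; parity-block  = parity-block
    }
    where
    parity-block : ∀ {i} → i < n →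
                   parity n (λ l → r (s + i) (s + l) ∧ isU (x (s + l))) ≡ r (s + i) (s + 0) ∧ false
    parity-block {i} i<n = begin
      parity n (λ l → F (s + l))                 ≡⟨ cong (_xor parity n (λ l → F (s + l))) head-false ⟨
      parity s F xor parity n (λ l → F (s + l))  ≡⟨ parity-+ s n F ⟨
      parity (s + n) F                           ≡⟨ V.parity-block I< ⟩
      r I 0 ∧ p                                  ≡⟨ cong (_∧ p) (closed-sym 0<s (m≤m+n s i) I<) ⟩
      false                                      ≡⟨ ∧-zeroʳ (r I (s + 0)) ⟨
      r I (s + 0) ∧ false                        ∎
      where
      I = s + i
      I< = +-monoʳ-< s i<n
      F = λ l → r I l ∧ isU (x l)
      head-false : parity s F ≡ false
      head-false = parity-false s (λ {l} l<s → cong (_∧ isU (x l)) (closed-sym l<s (m≤m+n s i) I<))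

module _ {J p x r} (V : Valid (suc J) p x r) (r0J : r 0 J ≡ true) where
  private module V = Valid V

  Valid-detach : Valid J (p xor isU (x J)) x r
  Valid-detach = record
    { isEquivalence = pullback (λ i → i) V.isEquivalence inject
    ; noncrossing   = λ a<b b<c c<d d<J → V.noncrossing a<b b<c c<d (inject d<J)
    ; nonzero       = λ i<J → V.nonzero (inject i<J)
    ; parity-block  = parity-block
    }
    where
    inject : ∀ {i} → i < J → i < suc J
    inject = m≤n⇒m≤1+n
    parity-block : ∀ {i} → i < J → parity J (λ l → r i l ∧ isU (x l)) ≡ r i 0 ∧ (p xor isU (x J))
    parity-block {i} i<J = begin
      parity J F                                   ≡⟨ xor-cancelʳ (parity J F) (r i 0 ∧ u) ⟨
      (parity J F xor (r i 0 ∧ u)) xor (r i 0 ∧ u) ≡⟨ cong (λ c → (parity J F xor (c ∧ u)) xor (r i 0 ∧ u))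
                                                           (V.congʳ (s≤s z≤n) ≤-refl (inject i<J) r0J) ⟩
      (parity J F xor F J) xor (r i 0 ∧ u)         ≡⟨ cong (_xor (r i 0 ∧ u)) (parity-suc J F) ⟨
      parity (suc J) F xor (r i 0 ∧ u)             ≡⟨ cong (_xor (r i 0 ∧ u)) (V.parity-block (inject i<J)) ⟩
      (r i 0 ∧ p) xor (r i 0 ∧ u)                  ≡⟨ ∧-distribˡ-xor (r i 0) p u ⟨
      r i 0 ∧ (p xor u)                            ∎
      where
      u = isU (x J)
      F = λ l → r i l ∧ isU (x l)

letter-of-singleton : ∀ {p x r} → Valid 1 p x r → x 0 ≡ label p
letter-of-singleton {p} {x} {r} V = trans (sym (label-isU (V.nonzero 0<1))) (cong label isU-x0)
  where
  module V = Valid V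
  0<1 = s≤s z≤n
  r00 = V.reflexive 0<1
  isU-x0 : isU (x 0) ≡ p
  isU-x0 = begin
    isU (x 0)                        ≡⟨ xor-identityʳ (isU (x 0)) ⟨
    isU (x 0) xor false              ≡⟨ cong (λ b → (b ∧ isU (x 0)) xor false) r00 ⟨
    (r 0 0 ∧ isU (x 0)) xor false    ≡⟨ V.parity-block 0<1 ⟩
    r 0 0 ∧ p                        ≡⟨ cong (_∧ p) r00 ⟩
    p                                ∎

Agree : ℕ → (ℕ → Letter) → (ℕ → ℕ → Bool) → (ℕ → Letter) → (ℕ → ℕ → Bool) → Set
Agree m x r y q = (∀ {i} → i < m → x i ≡ y i) × (∀ {i j} → i < m → j < m → r i j ≡ q i j)

Agree-++ : ∀ {s n p x r x₁ r₁ x₂ r₂} → Valid (s + n) p x r → Closed s (s + n) r →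
           Agree s x₁ r₁ x r → Agree n x₂ r₂ (λ i → x (s + i)) (λ i j → r (s + i) (s + j)) →
           Agree (s + n) (x₁ ++⟨ s ⟩ x₂) (r₁ ⊕⟨ s ⟩ r₂) x r
Agree-++ {s} {n} {p} {x} {r} {x₁} {r₁} {x₂} {r₂} V closed (x₁≗x , r₁≗r) (x₂≗x , r₂≗r) = letters , relation
  where
  letters : ∀ {i} → i < s + n → (x₁ ++⟨ s ⟩ x₂) i ≡ x i
  letters {i} i< with side s i
  ... | left i<s = x₁≗x i<s
  ... | right i′ = x₂≗x (+-cancelˡ-< s i′ n i<)
  relation : ∀ {i j} → i < s + n → j < s + n → (r₁ ⊕⟨ s ⟩ r₂) i j ≡ r i j
  relation {i} {j} i< j< with side s i | side s j
  ... | left i<s | left j<s = r₁≗r i<s j<s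
  ... | left i<s | right j′ = sym (closed i<s (m≤m+n s j′) j<)
  ... | right i′ | left j<s = sym (closed-sym V closed j<s (m≤m+n s i′) i<)
  ... | right i′ | right j′ = r₂≗r (+-cancelˡ-< s i′ n i<) (+-cancelˡ-< s j′ n j<)

module _ {j p x r} (V : Valid (suc (suc j)) p x r) (r0J : r 0 (suc j) ≡ true) where
  private
    module V = Valid V
    J = suc j

  collapse-congˡ : ∀ {i l} → i < suc J → l < suc J → r (collapse J i) l ≡ r i l
  collapse-congˡ {i} i< l< with m<1+n⇒m<n∨m≡n i<
  ... | inj₁ i<J = cong (λ i′ → r i′ _) (collapse-left i<J)
  ... | inj₂ refl = trans (cong (λ i′ → r i′ _) (collapse-at J)) (V.congˡ (s≤s z≤n) ≤-refl l< r0J)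

  collapse-congʳ : ∀ {i l} → i < suc J → l < suc J → r l (collapse J i) ≡ r l i
  collapse-congʳ {i} {l} i< l< =
    trans (V.symmetric-≡ l< (m≤n⇒m≤1+n (collapse-< i<))) (trans (collapse-congˡ i< l<) (V.symmetric-≡ i< l<))

  Agree-attach : ∀ {x₁ r₁ y} → Agree J x₁ r₁ x r → y ≡ x J →
                 Agree (suc J) (x₁ ++⟨ J ⟩ (λ _ → y)) (attach J r₁) x r
  Agree-attach {x₁} {r₁} {y} (x₁≗x , r₁≗r) y≡xJ = letters , relation
    where
    letters : ∀ {i} → i < suc J → (x₁ ++⟨ J ⟩ (λ _ → y)) i ≡ x i
    letters i< with m<1+n⇒m<n∨m≡n i<
    ... | inj₁ i<J  = trans (++-left x₁ (λ _ → y) i<J) (x₁≗x i<J)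
    ... | inj₂ refl = trans (++-at x₁ (λ _ → y) J) y≡xJ
    relation : ∀ {i l} → i < suc J → l < suc J → attach J r₁ i l ≡ r i l
    relation {i} {l} i< l< = begin
      r₁ (collapse J i) (collapse J l) ≡⟨ r₁≗r (collapse-< i<) (collapse-< l<) ⟩
      r (collapse J i) (collapse J l)  ≡⟨ collapse-congˡ i< (m≤n⇒m≤1+n (collapse-< l<)) ⟩
      r i (collapse J l)               ≡⟨ collapse-congʳ l< i< ⟩
      r i l                            ∎

Agree-++⁻ : ∀ s n {x₁ r₁ x₂ r₂ y₁ q₁ y₂ q₂} →
            Agree (s + n) (x₁ ++⟨ s ⟩ x₂) (r₁ ⊕⟨ s ⟩ r₂) (y₁ ++⟨ s ⟩ y₂) (q₁ ⊕⟨ s ⟩ q₂) →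
            Agree s x₁ r₁ y₁ q₁ × Agree n x₂ r₂ y₂ q₂
Agree-++⁻ s n {x₁} {r₁} {x₂} {r₂} {y₁} {q₁} {y₂} {q₂} (x≗y , r≗q) =
  ( (λ i<s → trans (sym (++-left x₁ x₂ i<s)) (trans (x≗y (inject i<s)) (++-left y₁ y₂ i<s)))
  , (λ i<s j<s → trans (sym (⊕-ll r₁ r₂ i<s j<s))
                         (trans (r≗q (inject i<s) (inject j<s)) (⊕-ll q₁ q₂ i<s j<s))) )
  , ( (λ {i} i<n → trans (sym (++-right x₁ x₂ s i)) (trans (x≗y (+-monoʳ-< s i<n)) (++-right y₁ y₂ s i)))
    , (λ {i} {j} i<n j<n → trans (sym (⊕-rr r₁ r₂ {s = s} i j))
                                 (trans (r≗q (+-monoʳ-< s i<n) (+-monoʳ-< s j<n)) (⊕-rr q₁ q₂ {s = s} i j))) )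
  where
  inject : ∀ {i} → i < s → i < s + n
  inject i<s = <-≤-trans i<s (m≤m+n s n)

Agree-attach⁻ : ∀ J {x₁ r₁ y₁ x₂ r₂ y₂} →
                Agree (suc J) (x₁ ++⟨ J ⟩ (λ _ → y₁)) (attach J r₁) (x₂ ++⟨ J ⟩ (λ _ → y₂)) (attach J r₂) →
                Agree J x₁ r₁ x₂ r₂ × y₁ ≡ y₂
Agree-attach⁻ J {x₁} {r₁} {y₁} {x₂} {r₂} {y₂} (x≗y , r≗q) =
  ( (λ i<J → trans (sym (++-left x₁ _ i<J)) (trans (x≗y (m≤n⇒m≤1+n i<J)) (++-left x₂ _ i<J)))
  , (λ i<J j<J → trans (sym (cong₂ r₁ (collapse-left i<J) (collapse-left j<J)))
                         (trans (r≗q (m≤n⇒m≤1+n i<J) (m≤n⇒m≤1+n j<J))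
                                (cong₂ r₂ (collapse-left i<J) (collapse-left j<J)))) )
  , trans (sym (++-at x₁ _ J)) (trans (x≗y ≤-refl) (++-at x₂ _ J))

-- Decoding trees

word : ∀ {m p} → Tree m p → ℕ → Letter
word nil                  = λ _ → E
word (single p t)         = (λ _ → label p) ++⟨ 1 ⟩ word t
word (join p j k _ b g a) = (word g ++⟨ suc j ⟩ (λ _ → label b)) ++⟨ suc (suc j) ⟩ word a

block : ∀ {m p} → Tree m p → ℕ → ℕ → Bool
block nil                  = λ _ _ → false
block (single p t)         = (λ _ _ → true) ⊕⟨ 1 ⟩ block t
block (join p j k _ b g a) = attach (suc j) (block g) ⊕⟨ suc (suc j) ⟩ block a

decode-valid : ∀ {m p} (t : Tree m p) → Valid m p (word t) (block t)
decode-valid nil                     = Valid-empty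
decode-valid (single p t)            = Valid-++ (s≤s z≤n) (Valid-singleton p) (decode-valid t)
decode-valid (join p j k refl b g a) = Valid-++ (s≤s z≤n) first-block (decode-valid a)
  where
  first-block : Valid (suc (suc j)) p (word g ++⟨ suc j ⟩ (λ _ → label b)) (attach (suc j) (block g))
  first-block = subst (λ q → Valid (suc (suc j)) q (word g ++⟨ suc j ⟩ (λ _ → label b)) (attach (suc j) (block g)))
                      (xor-cancelʳ p b)
                      (Valid-attach (decode-valid g) b)

lastTrue : ∀ n (f : ℕ → Bool) → f 0 ≡ true →
           ∃ λ J → J < suc n × f J ≡ true × (∀ {l} → J < l → l < suc n → f l ≡ false)
lastTrue zero    f f0 = 0 , s≤s z≤n , f0 , λ 0<l l<1 → ⊥-elim (<⇒≱ 0<l (≤-pred l<1))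
lastTrue (suc n) f f0 with f (suc n) in fn
... | true  = suc n , ≤-refl , fn , λ n<l l< → ⊥-elim (<⇒≱ n<l (≤-pred l<))
... | false with J , J< , fJ , last ← lastTrue n f f0 = J , m≤n⇒m≤1+n J< , fJ , later
  where
  later : ∀ {l} → J < l → l < suc (suc n) → f l ≡ false
  later J<l l< with m<1+n⇒m<n∨m≡n l<
  ... | inj₁ l<1+n = last J<l l<1+n
  ... | inj₂ refl  = fn

-- The hypothesis m ≡ 0 → p ≡ false is needed because Valid 0 true x r holds vacuously.
Decodable : ℕ → Set
Decodable m = ∀ {p x r} → Valid m p x r → (m ≡ 0 → p ≡ false) →
              Σ (Tree m p) λ t → Agree m (word t) (block t) x r

decode-surjective : ∀ m → Decodable m
decode-surjective = <-rec Decodable step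
  where
  step : ∀ m → (∀ {m′} → m′ < m → Decodable m′) → Decodable m
  step zero    _   _ p≡false with refl ← p≡false refl = nil , (λ ()) , (λ ())
  step (suc n) rec {p} {x} {r} V _ with lastTrue n (r 0) (Valid.reflexive V (s≤s z≤n))
  ... | zero , _ , _ , last = single p (proj₁ rest) , Agree-++ V closed first-agrees (proj₂ rest)
    where
    module V = Valid V
    closed : Closed 1 (suc n) r
    closed (s≤s z≤n) 1≤l l< = last 1≤l l<
    first-agrees : Agree 1 (λ _ → label p) (λ _ _ → true) x r
    first-agrees = (λ { (s≤s z≤n) → sym (letter-of-singleton (Valid-take V closed)) })
                 , (λ { (s≤s z≤n) (s≤s z≤n) → sym (V.reflexive (s≤s z≤n)) })
    rest = rec ≤-refl (Valid-drop V closed (s≤s z≤n)) (λ _ → refl)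
  ... | suc j , J< , r0J , last with k , refl ← m≤n⇒∃[o]m+o≡n (≤-pred J<) =
    join p j k refl u (proj₁ inner) (proj₁ rest) ,
    Agree-++ V closed (Agree-attach first r0J (proj₂ inner) x≡) (proj₂ rest)
    where
    module V = Valid V
    closed = closed-after-last V J< r0J last
    first = Valid-take V closed
    u = isU (x (suc j))
    x≡ : label u ≡ x (suc j)
    x≡ = label-isU (V.nonzero J<)
    inner = rec J< (Valid-detach first r0J) (λ ())
    rest = rec (s≤s (m≤n+m k (suc j))) (Valid-drop V closed (s≤s z≤n)) (λ _ → refl)

first-block-single : ∀ {n} p (t : Tree n false) {l} → 0 < l → block (single p t) 0 l ≡ false
first-block-single p t 0<l = ⊕-lr (λ _ _ → true) (block t) (s≤s z≤n) 0<l

first-block-join-beyond : ∀ {m} p j k e b (g : Tree (suc j) (p xor b)) (a : Tree k false) {l} →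
                          suc j < l → block (join {m} p j k e b g a) 0 l ≡ false
first-block-join-beyond p j k e b g a j<l = ⊕-lr (attach (suc j) (block g)) (block a) (s≤s z≤n) j<l

first-block-join-last : ∀ {m} p j k e b (g : Tree (suc j) (p xor b)) (a : Tree k false) →
                        block (join {m} p j k e b g a) 0 (suc j) ≡ true
first-block-join-last p j k e b g a = begin
  (attach (suc j) (block g) ⊕⟨ suc (suc j) ⟩ block a) 0 (suc j)
    ≡⟨ ⊕-ll (attach (suc j) (block g)) (block a) {s = suc (suc j)} (s≤s z≤n) ≤-refl ⟩
  block g 0 (collapse (suc j) (suc j)) ≡⟨ cong (block g 0) (collapse-at (suc j)) ⟩
  block g 0 0                          ≡⟨ Valid.reflexive (decode-valid g) (s≤s z≤n) ⟩
  true                                 ∎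

disagree : ∀ {m x r y q l} → Agree m x r y q → l < m → r 0 l ≡ false → q 0 l ≡ true → ⊥
disagree (_ , r≗q) l<m r0l q0l = false≢true (trans (sym r0l) (trans (r≗q (≤-<-trans z≤n l<m) l<m) q0l))

Agree-sym : ∀ {m x r y q} → Agree m x r y q → Agree m y q x r
Agree-sym (x≗y , r≗q) = sym ∘ x≗y , λ i<m j<m → sym (r≗q i<m j<m)

decode-injective : ∀ {m p} (t t′ : Tree m p) → Agree m (word t) (block t) (word t′) (block t′) → t ≡ t′
decode-injective nil nil _ = refl
decode-injective (single p t) (single .p t′) agree =
  cong (single p) (decode-injective t t′ (proj₂ (Agree-++⁻ 1 _ agree)))
decode-injective (single p t) (join .p j k e b g a) agree =
  ⊥-elim (disagree agree (split-< j k e) (first-block-single p t {suc j} (s≤s z≤n)) (first-block-join-last p j k e b g a))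
decode-injective (join p j k e b g a) (single .p t) agree =
  ⊥-elim (disagree (Agree-sym agree) (split-< j k e)
                   (first-block-single p t {suc j} (s≤s z≤n)) (first-block-join-last p j k e b g a))
decode-injective (join p j k refl b g a) (join .p j′ k′ e′ b′ g′ a′) agree with <-cmp j j′
... | tri< j<j′ _ _ = ⊥-elim (disagree agree (split-< j′ k′ e′)
                        (first-block-join-beyond p j k refl b g a (s≤s j<j′))
                        (first-block-join-last p j′ k′ e′ b′ g′ a′))
... | tri> _ _ j′<j = ⊥-elim (disagree (Agree-sym agree) (split-< j k refl)
                        (first-block-join-beyond p j′ k′ e′ b′ g′ a′ (s≤s j′<j))
                        (first-block-join-last p j k refl b g a))
... | tri≈ _ refl _ with refl ← +-cancelˡ-≡ (suc (suc j)) k′ k e′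
  with refl ← ≡-irrelevant e′ refl
  with first-agrees , a-agrees ← Agree-++⁻ (suc (suc j)) k agree
  with g-agrees , b≡b′ ← Agree-attach⁻ (suc j) first-agrees
  with refl ← label-injective b≡b′ =
  cong₂ (join p j k refl b) (decode-injective g g′ g-agrees) (decode-injective a a′ a-agrees)

-- Structures as vectors

odd : ℕ → Bool
odd zero    = false
odd (suc n) = not (odd n)

2∣⇒¬odd : ∀ {n} → 2 ∣ n → odd n ≡ false
2∣⇒¬odd (divides q refl) = even q
  where
  even : ∀ q → odd (q * 2) ≡ false
  even zero    = refl
  even (suc q) = trans (not-involutive (odd (q * 2))) (even q)

¬odd⇒2∣ : ∀ n → odd n ≡ false → 2 ∣ n
¬odd⇒2∣ zero          _    = divides 0 refl
¬odd⇒2∣ (suc (suc n)) even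
  with divides q refl ← ¬odd⇒2∣ n (trans (sym (not-involutive (odd n))) even) = divides (suc q) refl

odd-length-filter : ∀ {A : Set} {P : Pred A 0ℓ} (P? : Decidable P) {m} (g : Fin m → A) (f : ℕ → Bool) →
                    (∀ j → P (g j) → f (toℕ j) ≡ true) → (∀ j → f (toℕ j) ≡ true → P (g j)) →
                    odd (length (filter P? (List.tabulate g))) ≡ parity m f
odd-length-filter P? {zero}  g f P⇒f f⇒P = refl
odd-length-filter P? {suc m} g f P⇒f f⇒P
  with P? (g Fin.zero) | odd-length-filter P? (g ∘ Fin.suc) (f ∘ suc) (P⇒f ∘ Fin.suc) (f⇒P ∘ Fin.suc)
... | yes P0 | rest = trans (cong not rest) (cong (_xor parity m (f ∘ suc)) (sym (P⇒f Fin.zero P0)))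
... | no ¬P0 | rest = trans rest (cong (_xor parity m (f ∘ suc)) (sym (¬-not (¬P0 ∘ f⇒P Fin.zero))))

record Represents m (x̂ : ℕ → Letter) (r̂ : ℕ → ℕ → Bool) (x : Vec Letter m) (R : Vec (Vec Bool m) m) :
                  Set where
  constructor represents
  field
    letters  : ∀ i → x̂ (toℕ i) ≡ lookup x i
    relation : ∀ i j → r̂ (toℕ i) (toℕ j) ≡ lookup (lookup R i) j

module _ {m x̂ r̂ x R} (rep : Represents m x̂ r̂ x R) where
  open Represents rep renaming (letters to x̂≗x; relation to r̂≗R)

  private
    same⁺ : ∀ {i j} → Same x R i j → r̂ (toℕ i) (toℕ j) ≡ true
    same⁺ {i} {j} s = trans (r̂≗R i j) s

    same⁻ : ∀ {i j} → r̂ (toℕ i) (toℕ j) ≡ true → Same x R i j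
    same⁻ {i} {j} e = trans (sym (r̂≗R i j)) e

    x̂-at : ∀ {i} (i<m : i < m) → x̂ i ≡ lookup x (fromℕ< i<m)
    x̂-at i<m = trans (cong x̂ (sym (toℕ-fromℕ< i<m))) (x̂≗x (fromℕ< i<m))

    r̂-at : ∀ {i j} (i<m : i < m) (j<m : j < m) → r̂ i j ≡ lookup (lookup R (fromℕ< i<m)) (fromℕ< j<m)
    r̂-at i<m j<m =
      trans (cong₂ r̂ (sym (toℕ-fromℕ< i<m)) (sym (toℕ-fromℕ< j<m))) (r̂≗R (fromℕ< i<m) (fromℕ< j<m))

  odd-uCountInBlock : ∀ i → odd (uCountInBlock x R i) ≡ parity m (λ l → r̂ (toℕ i) l ∧ isU (x̂ l))
  odd-uCountInBlock i = odd-length-filter (λ j → Same? x R i j ×-dec (lookup x j ≟L U)) (λ j → j) _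
    (λ j (s , xj≡U) → ∧≡true⁺ (same⁺ s) (cong isU (trans (x̂≗x j) xj≡U)))
    (λ j e → let rij , xj = ∧≡true⁻ e in same⁻ rij , trans (sym (x̂≗x j)) (isU≡true⇒≡U xj))

  Valid⇒InΩpos : Valid m false x̂ r̂ → InΩpos x R
  Valid⇒InΩpos V = (partition , noncrossing , evenU , singletonsE) , inZ
    where
    module V = Valid V
    inZ : ∀ i → InZ x R i
    inZ i = V.nonzero (toℕ<n i) ∘ trans (x̂≗x i)
    symmetric : ∀ i j → Same x R i j → Same x R j i
    symmetric i j = same⁻ ∘ V.symmetric (toℕ<n i) (toℕ<n j) ∘ same⁺
    transitive : ∀ i j l → Same x R i j → Same x R j l → Same x R i l
    transitive i j l s₁ s₂ = same⁻ (V.transitive (toℕ<n i) (toℕ<n j) (toℕ<n l) (same⁺ s₁) (same⁺ s₂))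
    partition : IsPartitionOfZ x R
    partition = (λ i j _ → inZ i , inZ j) , (λ i _ → same⁻ (V.reflexive (toℕ<n i))) , symmetric , transitive
    noncrossing : NonCrossing x R
    noncrossing a b c d (a<b , b<c , c<d , sac , sbd , ¬sab) =
      V.noncrossing a<b b<c c<d (toℕ<n d) (same⁺ sac) (same⁺ sbd) (¬-not (¬sab ∘ same⁻))
    block-parity : ∀ i → parity m (λ l → r̂ (toℕ i) l ∧ isU (x̂ l)) ≡ false
    block-parity i = trans (V.parity-block (toℕ<n i)) (∧-zeroʳ _)
    evenU : EvenU x R
    evenU i _ = ¬odd⇒2∣ _ (trans (odd-uCountInBlock i) (block-parity i))
    singletonsE : SingletonsE x R
    singletonsE i _ alone = trans (sym (x̂≗x i)) (E-of (V.nonzero (toℕ<n i)) isU≡false)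
      where
      others : ∀ {t} → t < m → t ≢ toℕ i → r̂ (toℕ i) t ∧ isU (x̂ t) ≡ false
      others {t} t<m t≢i = cong (_∧ isU (x̂ t)) (¬-not λ rit → t≢i (trans (sym (toℕ-fromℕ< t<m))
        (cong toℕ (alone (fromℕ< t<m) (same⁻ (trans (cong (r̂ (toℕ i)) (toℕ-fromℕ< t<m)) rit))))))
      isU≡false : isU (x̂ (toℕ i)) ≡ false
      isU≡false = trans (sym (cong (_∧ isU (x̂ (toℕ i))) (V.reflexive (toℕ<n i))))
                        (trans (sym (parity-only m _ (toℕ<n i) others)) (block-parity i))
      E-of : ∀ {l} → l ≢ O → isU l ≡ false → l ≡ E
      E-of {O} l≢O _ = ⊥-elim (l≢O refl)
      E-of {E} _   _ = refl

  InΩpos⇒Valid : InΩpos x R → Valid m false x̂ r̂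
  InΩpos⇒Valid (((_ , reflexive , symmetric , transitive) , noncrossing , evenU , _) , inZ) = record
    { isEquivalence = record
      { reflexive  = λ i<m → trans (r̂-at i<m i<m) (reflexive _ (inZ _))
      ; symmetric  = λ i<m j<m rij → trans (r̂-at j<m i<m) (symmetric _ _ (trans (sym (r̂-at i<m j<m)) rij))
      ; transitive = λ i<m j<m l<m rij rjl → trans (r̂-at i<m l<m)
                       (transitive _ _ _ (trans (sym (r̂-at i<m j<m)) rij) (trans (sym (r̂-at j<m l<m)) rjl))
      }
    ; noncrossing   = λ a<b b<c c<d d<m rac rbd rab →
        let c<m = <-trans c<d d<m; b<m = <-trans b<c c<m; a<m = <-trans a<b b<m in
        noncrossing (fromℕ< a<m) (fromℕ< b<m) (fromℕ< c<m) (fromℕ< d<m)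
          ( fin-< a<m b<m a<b , fin-< b<m c<m b<c , fin-< c<m d<m c<d
          , trans (sym (r̂-at a<m c<m)) rac , trans (sym (r̂-at b<m d<m)) rbd
          , λ sab → false≢true (trans (sym rab) (trans (r̂-at a<m b<m) sab)) )
    ; nonzero       = λ i<m xi≡O → inZ (fromℕ< i<m) (trans (sym (x̂-at i<m)) xi≡O)
    ; parity-block  = λ {i} i<m → begin
        parity m (λ l → r̂ i l ∧ isU (x̂ l))
          ≡⟨ cong (λ i′ → parity m (λ l → r̂ i′ l ∧ isU (x̂ l))) (toℕ-fromℕ< i<m) ⟨
        parity m (λ l → r̂ (toℕ (fromℕ< i<m)) l ∧ isU (x̂ l))
          ≡⟨ odd-uCountInBlock (fromℕ< i<m) ⟨
        odd (uCountInBlock x R (fromℕ< i<m))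
          ≡⟨ 2∣⇒¬odd (evenU _ (inZ _)) ⟩
        false
          ≡⟨ ∧-zeroʳ (r̂ i 0) ⟨
        r̂ i 0 ∧ false ∎
    }
    where
    fin-< : ∀ {i j} (i<m : i < m) (j<m : j < m) → i < j → toℕ (fromℕ< i<m) < toℕ (fromℕ< j<m)
    fin-< i<m j<m = subst₂ _<_ (sym (toℕ-fromℕ< i<m)) (sym (toℕ-fromℕ< j<m))

represents-agree : ∀ {m x̂ r̂ ŷ q̂ x R} → Represents m x̂ r̂ x R → Represents m ŷ q̂ x R → Agree m x̂ r̂ ŷ q̂
represents-agree {m} {x̂} {r̂} {ŷ} {q̂} (represents x̂≗x r̂≗R) (represents ŷ≗x q̂≗R) = letters , relation
  where
  letters : ∀ {i} → i < m → x̂ i ≡ ŷ i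
  letters i<m = subst (λ i → x̂ i ≡ ŷ i) (toℕ-fromℕ< i<m) (trans (x̂≗x _) (sym (ŷ≗x _)))
  relation : ∀ {i j} → i < m → j < m → r̂ i j ≡ q̂ i j
  relation i<m j<m =
    subst₂ (λ i j → r̂ i j ≡ q̂ i j) (toℕ-fromℕ< i<m) (toℕ-fromℕ< j<m) (trans (r̂≗R _ _) (sym (q̂≗R _ _)))

agree-represents : ∀ {m x̂ r̂ ŷ q̂ x R} → Agree m x̂ r̂ ŷ q̂ → Represents m ŷ q̂ x R → Represents m x̂ r̂ x R
agree-represents (x̂≗ŷ , r̂≗q̂) (represents ŷ≗x q̂≗R) =
  represents (λ i → trans (x̂≗ŷ (toℕ<n i)) (ŷ≗x i))
             (λ i j → trans (r̂≗q̂ (toℕ<n i) (toℕ<n j)) (q̂≗R i j))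

tabulateΩ : ∀ m → (ℕ → Letter) → (ℕ → ℕ → Bool) → Vec Letter m × Vec (Vec Bool m) m
tabulateΩ m x̂ r̂ = tabulate (x̂ ∘ toℕ) , tabulate (λ i → tabulate (r̂ (toℕ i) ∘ toℕ))

represents-tabulateΩ : ∀ m x̂ r̂ → Represents m x̂ r̂ (proj₁ (tabulateΩ m x̂ r̂)) (proj₂ (tabulateΩ m x̂ r̂))
represents-tabulateΩ m x̂ r̂ = represents
    (λ i → sym (lookup∘tabulate (x̂ ∘ toℕ) i))
    (λ i j → sym (trans (cong (λ row → lookup row j) (lookup∘tabulate _ i))
                        (lookup∘tabulate (r̂ (toℕ i) ∘ toℕ) j)))

tabulateΩ-represented : ∀ {m x̂ r̂ x R} → Represents m x̂ r̂ x R → tabulateΩ m x̂ r̂ ≡ (x , R)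
tabulateΩ-represented {x = x} {R} (represents x̂≗x r̂≗R) = cong₂ _,_
  (trans (tabulate-cong x̂≗x) (tabulate∘lookup x))
  (trans (tabulate-cong (λ i → trans (tabulate-cong (r̂≗R i)) (tabulate∘lookup (lookup R i)))) (tabulate∘lookup R))

tabulateΩ-injective : ∀ {m x̂ r̂ ŷ q̂} → tabulateΩ m x̂ r̂ ≡ tabulateΩ m ŷ q̂ → Agree m x̂ r̂ ŷ q̂
tabulateΩ-injective {m} {x̂} {r̂} {ŷ} {q̂} eq = represents-agree (represents-tabulateΩ m x̂ r̂)
  (subst (λ (x , R) → Represents m ŷ q̂ x R) (sym eq) (represents-tabulateΩ m ŷ q̂))

represents-lookupℕ : ∀ {m} (x : Vec Letter m) R →
                     Represents m (lookupℕ E x) (lookupℕ (λ _ → false) (Vec.map (lookupℕ false) R)) x R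
represents-lookupℕ x R = represents (lookupℕ-toℕ E x) λ i j → begin
  lookupℕ (λ _ → false) rows (toℕ i) (toℕ j) ≡⟨ cong (λ row → row (toℕ j)) (lookupℕ-toℕ (λ _ → false) rows i) ⟩
  lookup rows i (toℕ j)                       ≡⟨ cong (λ row → row (toℕ j)) (lookup-map i (lookupℕ false) R) ⟩
  lookupℕ false (lookup R i) (toℕ j)          ≡⟨ lookupℕ-toℕ false (lookup R i) j ⟩
  lookup (lookup R i) j                       ∎
  where
  rows = Vec.map (lookupℕ false) R

-- Counting Ω_pos

allVecs⁺ : ∀ {A : Set} {xs : List A} → Unique xs → ∀ n → Unique (allVecs xs n)
allVecs⁺ xs! zero    = All.[] ∷ []
allVecs⁺ {xs = xs} xs! (suc n) = concatMap⁺ xs! (λ a → map⁺ ∷-injectiveʳ (allVecs⁺ xs! n)) heads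
  where
  heads : ∀ {a b v} → v ∈ map (a ∷_) (allVecs xs n) → v ∈ map (b ∷_) (allVecs xs n) → a ≡ b
  heads v∈ v∈′ with _ , _ , refl ← ∈-map⁻ _ v∈ | _ , _ , v≡ ← ∈-map⁻ _ v∈′ = ∷-injectiveˡ v≡

∈-allVecs : ∀ {A : Set} {xs : List A} → (∀ a → a ∈ xs) → ∀ {n} (v : Vec A n) → v ∈ allVecs xs n
∈-allVecs ∈xs []      = here refl
∈-allVecs ∈xs (a ∷ v) = ∈-concatMap⁺′ (λ a → map (a ∷_) _) (∈-map⁺ (a ∷_) (∈-allVecs ∈xs v)) (∈xs a)

allLetters⁺ : Unique allLetters
allLetters⁺ = ((λ ()) All.∷ (λ ()) All.∷ All.[]) ∷ ((λ ()) All.∷ All.[]) ∷ All.[] ∷ []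

∈-allLetters : ∀ l → l ∈ allLetters
∈-allLetters O = here refl
∈-allLetters U = there (here refl)
∈-allLetters E = there (there (here refl))

candidates⁺ : ∀ h → Unique (candidates h)
candidates⁺ h = cartesianProduct⁺ (allVecs⁺ allLetters⁺ h) (allVecs⁺ (allVecs⁺ allBools⁺ h) h)

∈-candidates : ∀ {h} (x : Vec Letter h) R → (x , R) ∈ candidates h
∈-candidates x R = ∈-cartesianProduct⁺ (∈-allVecs ∈-allLetters x) (∈-allVecs (∈-allVecs ∈-allBools) R)

encode : ∀ {m} → Tree m false → Vec Letter m × Vec (Vec Bool m) m
encode {m} t = tabulateΩ m (word t) (block t)

encode-injective : ∀ {m} {t t′ : Tree m false} → encode t ≡ encode t′ → t ≡ t′
encode-injective {t = t} {t′} = decode-injective t t′ ∘ tabulateΩ-injective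

encode-surjective : ∀ {m} (x : Vec Letter m) R → InΩpos x R → ∃ λ (t : Tree m false) → encode t ≡ (x , R)
encode-surjective {m} x R Ω
  with t , agrees ← decode-surjective m (InΩpos⇒Valid (represents-lookupℕ x R) Ω) (λ _ → refl) =
  t , tabulateΩ-represented (agree-represents agrees (represents-lookupℕ x R))

encode-InΩpos : ∀ {m} (t : Tree m false) → InΩpos (proj₁ (encode t)) (proj₂ (encode t))
encode-InΩpos {m} t = Valid⇒InΩpos (represents-tabulateΩ m (word t) (block t)) (decode-valid t)

trees : ∀ m → List (Tree m false)
trees m = trees≤ m m false

InΩpos?-pair : ∀ {m} (z : Vec Letter m × Vec (Vec Bool m) m) → Dec (InΩpos (proj₁ z) (proj₂ z))
InΩpos?-pair z = InΩpos? (proj₁ z) (proj₂ z)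

Ωpos⇔encodings : ∀ m {z} → z ∈ filter InΩpos?-pair (candidates m) ⇔ z ∈ map encode (trees m)
Ωpos⇔encodings m = mk⇔ from to
  where
  from : ∀ {z} → z ∈ filter InΩpos?-pair (candidates m) → z ∈ map encode (trees m)
  from {x , R} z∈ with t , refl ← encode-surjective x R (proj₂ (∈-filter⁻ InΩpos?-pair {xs = candidates m} z∈)) =
    ∈-map⁺ encode (∈-trees≤ m t ≤-refl)
  to : ∀ {z} → z ∈ map encode (trees m) → z ∈ filter InΩpos?-pair (candidates m)
  to z∈ with t , _ , refl ← ∈-map⁻ encode z∈ = ∈-filter⁺ InΩpos?-pair (∈-candidates _ _) (encode-InΩpos t)

cardΩpos≡superCatalan : ∀ m → cardΩpos m ≡ superCatalan m
cardΩpos≡superCatalan m = begin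
  cardΩpos m                      ≡⟨ unique-⇔-length (filter⁺ InΩpos?-pair (candidates⁺ m))
                                                     (map⁺ encode-injective (trees≤⁺ m m false))
                                                     (Ωpos⇔encodings m) ⟩
  length (map encode (trees m))   ≡⟨ length-map encode (trees m) ⟩
  length (trees m)                ≡⟨ length-trees≤-false m m ≤-refl ⟩
  superCatalan m                  ∎

lemma7 : (h : ℕ) → cardΩpos (suc h) ≡ superCatalan (suc h)
lemma7 h = cardΩpos≡superCatalan (suc h)
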